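{- Let $p$ be a prime and let $m\ge1$, $k\ge2$ be integers. Then for $G=\mathbb{Z}_{p^m}$, $$p^{1/k}-1\le f^{(D)}_G(k)=f^{(D)}(p,k).$$
   Context: For a finite abelian group $G$ (written additively) and a non-empty set $A\subseteq\mathbb{Z}\setminus\{0\}$, the weighted Davenport constant $D_A(G)$ is the least positive integer $k$ such that for every sequence $(x_1,\ldots,x_k)$ of elements of $G$ there exist a non-empty subsequence $(x_{i_1},\ldots,x_{i_t})$ and elements $a_1,\ldots,a_t\in A$ with $\sum_{j=1}^t a_jx_{i_j}=0$. For $G$ of exponent $n$ and an integer $k\ge 2$, $f^{(D)}_G(k):=\min\{|A|:\emptyset\ne A\subseteq[1,n-1],\ D_A(G)\le k\}$ (and $\infty$ if no such $A$ exists). For the cyclic group $\mathbb{Z}_n$ write $f^{(D)}(n,k):=f^{(D)}_{\mathbb{Z}_n}(k)$. -}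

module Defs where

open import Data.Nat using (ℕ; zero; suc; _+_; _*_; _^_; _≤_)
open import Data.Nat.Divisibility using (_∣_)
open import Data.Fin using (Fin; toℕ) renaming (zero to fzero; suc to fsuc)
open import Data.Fin.Subset using (Subset; _∈_; _∉_; Nonempty; ∣_∣)
open import Data.Vec using (lookup)
open import Data.Bool using (if_then_else_)
open import Data.Maybe using (Maybe; just; nothing)
open import Data.Product using (Σ; _×_; ∃)
open import Data.Empty using (⊥)
open import Relation.Binary.PropositionalEquality using (_≡_)

sumFin : ∀ {j : ℕ} → (Fin j → ℕ) → ℕ
sumFin {zero} f = 0
sumFin {suc j} f = f fzero + sumFin (λ i → f (fsuc i))

-- The cyclic group ℤ_n is modelled by Fin n (residues 0..n-1), with
-- x = 0 in ℤ_n iff n ∣ (representative).  A weight set A ⊆ [1, n-1]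
-- is a Subset (Fin n) not containing 0.
WeightSet : ℕ → Set
WeightSet n = Subset n

InRange : ∀ {n} → WeightSet n → Set
InRange {n} A = (a : Fin n) → a ∈ A → 1 ≤ toℕ a

ZeroSumProp : (n : ℕ) → WeightSet n → ℕ → Set
ZeroSumProp n A j =
  (x : Fin j → Fin n) →
  Σ (Subset j) λ S → Nonempty S ×
  Σ (Fin j → Fin n) λ a → ((i : Fin j) → i ∈ S → a i ∈ A) ×
  (n ∣ sumFin (λ i → if lookup S i then toℕ (a i) * toℕ (x i) else 0))

-- D_A(ℤ_n) ≤ k : D_A is the least positive j with ZeroSumProp n A j,
-- so D_A ≤ k iff some positive j ≤ k has the property.
DavenportLE : (n : ℕ) → WeightSet n → ℕ → Set
DavenportLE n A k = Σ ℕ λ j → (1 ≤ j) × (j ≤ k) × ZeroSumProp n A j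

Admissible : (n k : ℕ) → WeightSet n → Set
Admissible n k A = Nonempty A × InRange A × DavenportLE n A k

-- fD n k v : "f^(D)(n,k) = v", where v = just s is a finite value s
-- (the minimum size of an admissible A) and v = nothing means ∞.
fD : ℕ → ℕ → Maybe ℕ → Set
fD n k (just s) =
  (Σ (WeightSet n) λ A → Admissible n k A × ∣ A ∣ ≡ s)
  × ((A : WeightSet n) → Admissible n k A → s ≤ ∣ A ∣)
fD n k nothing = (A : WeightSet n) → Admissible n k A → ⊥

module Submission where

-- Proof structure.
--  * Lifting (module Lift): if B ⊆ [1,p-1] is admissible for ℤ_p, then its
--    image under b ↦ p^{m-1}·b is admissible for ℤ_{p^m}: a weighted zero sum
--    of the residues mod p, multiplied by p^{m-1}, vanishes mod p^m.
--  * Descent (module Descend): if A ⊆ [1,p^m-1] is admissible for ℤ_{p^m},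
--    then its image under a ↦ (unit part of a) mod p is admissible for ℤ_p:
--    in a zero sum Σ a_i y_i ≡ 0 (mod p^m), divide by the least power p^t
--    dividing a weight and keep the terms of minimal valuation.
--  * Images are no larger than the sets, so both problems have the same
--    minimum (fD-transfer); the minimum exists because admissibility is
--    decidable, every quantifier ranging over a finite set (fD-exists).
--  * Lower bound (module LowerBound): a sequence of length k in ℤ_p without
--    weighted zero sums is built greedily as long as |A|·(|A|+1)^{k-1} < p,
--    each new term avoiding one root per pair (weight, previous subsum).

open import Data.Bool using (true; false; if_then_else_)
open import Data.Empty using (⊥-elim)
open import Data.Fin using (Fin; toℕ; fromℕ<) renaming (zero to fzero; suc to fsuc)
open import Data.Fin.Properties using (any?; all?; ¬∀⟶∃¬; pigeonhole; toℕ<n; toℕ-fromℕ<)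
open import Data.Fin.Subset using (Subset; _∈_; _⊆_; Nonempty; ∣_∣; ⁅_⁆; _∪_; _∩_; ∁; ⊥)
open import Data.Fin.Subset.Properties
  using (_∈?_; nonempty?; anySubset?; x∈p∩q⁺; p∩q⊆p; x∈∁p⇒x∉p; ∉⊥; x∈⁅x⁆; x∈⁅y⁆⇒x≡y; x∈p∪q⁻; p⊆p∪q; q⊆p∪q; ∣⊥∣≡0; ∪-identityˡ)
open import Data.List as L using (List; length; cartesianProductWith; cartesianProduct; _++_)
open import Data.List.Properties using (length-map; length-++)
open import Data.List.Membership.Propositional using () renaming (_∈_ to _∈ₗ_)
open import Data.List.Membership.Propositional.Properties
  using (∈-map⁺; ∈-map⁻; ∈-++⁺ˡ; ∈-++⁺ʳ; ∈-lookup; ∈-cartesianProductWith⁺; ∈-cartesianProduct⁺; ∈-cartesianProduct⁻)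
open import Data.List.Relation.Unary.Any as Any using (Any)
open import Data.List.Relation.Unary.Any.Properties using (lookup-index)
open import Data.Maybe using (Maybe; just; nothing)
open import Data.Nat using (ℕ; zero; suc; _+_; _*_; _^_; _∸_; _≤_; _<_; _≤?_; _≟_; _%_; z≤n; s≤s; z<s; NonZero; >-nonZero; >-nonZero⁻¹)
open import Data.Nat.Properties
open import Data.Nat.DivMod using (%-distribˡ-+; %-distribˡ-*; %-remove-+ˡ; m%n%n≡m%n; m%n<n)
open import Data.Nat.Divisibility
  using (_∣_; _∣?_; divides; m∣m*n; ∣m⇒∣m*n; ∣-trans; ∣m+n∣m⇒∣n; *-cancelˡ-∣; *-monoʳ-∣; >⇒∤; m%n≡0⇒n∣m; n∣m⇒m%n≡0)
open import Data.Nat.Induction using (<-rec)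
open import Data.Nat.Primality using (Prime; euclidsLemma)
open import Data.Nat.Tactic.RingSolver using (solve-∀)
open import Data.Product using (Σ; _×_; ∃; _,_; proj₁; proj₂)
open import Data.Sum using (inj₁; inj₂)
open import Data.Vec using ([]; _∷_; lookup; tabulate; here; there)
open import Data.Vec.Properties using (lookup∘tabulate; []=⇒lookup; lookup⇒[]=)
open import Function using (_∘_)
open import Relation.Binary.PropositionalEquality
open import Relation.Nullary using (Dec; yes; no; ¬_; does)
open import Relation.Nullary.Decidable using (_×-dec_; _→-dec_; map′)

open import Defs

sumS : ∀ {j} → Subset j → (Fin j → ℕ) → ℕ
sumS S f = sumFin (λ i → if lookup S i then f i else 0)

tail : ∀ {j s} {S : Subset j} {P : Fin (suc j) → Set} →
  (∀ i → i ∈ s ∷ S → P i) → ∀ i → i ∈ S → P (fsuc i)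
tail h i i∈S = h (fsuc i) (there i∈S)

sumS-cong : ∀ {j} (S : Subset j) {f g : Fin j → ℕ} →
  (∀ i → i ∈ S → f i ≡ g i) → sumS S f ≡ sumS S g
sumS-cong []          eq = refl
sumS-cong (true ∷ S)  eq = cong₂ _+_ (eq fzero here) (sumS-cong S (tail eq))
sumS-cong (false ∷ S) eq = sumS-cong S (tail eq)

sumS-* : ∀ {j} (S : Subset j) (c : ℕ) (f : Fin j → ℕ) →
  sumS S (λ i → c * f i) ≡ c * sumS S f
sumS-* []          c f = sym (*-zeroʳ c)
sumS-* (true ∷ S)  c f =
  trans (cong (c * f fzero +_) (sumS-* S c (λ i → f (fsuc i))))
        (sym (*-distribˡ-+ c (f fzero) _))
sumS-* (false ∷ S) c f = sumS-* S c (λ i → f (fsuc i))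

sumS-% : ∀ {j} (S : Subset j) {d} .{{_ : NonZero d}} {f g : Fin j → ℕ} →
  (∀ i → i ∈ S → f i % d ≡ g i % d) → sumS S f % d ≡ sumS S g % d
sumS-% []          eq = refl
sumS-% (true ∷ S) {d} {f} {g} eq = begin
    (f fzero + sumS S (λ i → f (fsuc i))) % d
  ≡⟨ %-distribˡ-+ (f fzero) _ d ⟩
    (f fzero % d + sumS S (λ i → f (fsuc i)) % d) % d
  ≡⟨ cong₂ (λ x y → (x + y) % d) (eq fzero here) (sumS-% S (tail eq)) ⟩
    (g fzero % d + sumS S (λ i → g (fsuc i)) % d) % d
  ≡⟨ %-distribˡ-+ (g fzero) _ d ⟨
    (g fzero + sumS S (λ i → g (fsuc i))) % d ∎
  where open ≡-Reasoning
sumS-% (false ∷ S) eq = sumS-% S (tail eq)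

tail₂ : ∀ {j s c} {S C : Subset j} {P : Fin (suc j) → Set} →
  (∀ i → i ∈ s ∷ S → i ∈ c ∷ C → P i) → ∀ i → i ∈ S → i ∈ C → P (fsuc i)
tail₂ h i i∈S i∈C = h (fsuc i) (there i∈S) (there i∈C)

sumS-%-∩ : ∀ {j} (S C : Subset j) {d} .{{_ : NonZero d}} {f g : Fin j → ℕ} →
  (∀ i → i ∈ S → i ∈ C → f i % d ≡ g i % d) → (∀ i → i ∈ S → i ∈ ∁ C → d ∣ f i) →
  sumS S f % d ≡ sumS (S ∩ C) g % d
sumS-%-∩ [] [] inC outC = refl
sumS-%-∩ (true ∷ S) (true ∷ C) {d} {f} {g} inC outC = begin
    (f fzero + sumS S (λ i → f (fsuc i))) % d
  ≡⟨ %-distribˡ-+ (f fzero) _ d ⟩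
    (f fzero % d + sumS S (λ i → f (fsuc i)) % d) % d
  ≡⟨ cong₂ (λ x y → (x + y) % d) (inC fzero here here) (sumS-%-∩ S C (tail₂ inC) (tail₂ outC)) ⟩
    (g fzero % d + sumS (S ∩ C) (λ i → g (fsuc i)) % d) % d
  ≡⟨ %-distribˡ-+ (g fzero) _ d ⟨
    (g fzero + sumS (S ∩ C) (λ i → g (fsuc i))) % d ∎
  where open ≡-Reasoning
sumS-%-∩ (true ∷ S) (false ∷ C) {f = f} inC outC =
  trans (%-remove-+ˡ (sumS S (λ i → f (fsuc i))) (outC fzero here here))
        (sumS-%-∩ S C (tail₂ inC) (tail₂ outC))
sumS-%-∩ (false ∷ S) (_ ∷ C) inC outC = sumS-%-∩ S C (tail₂ inC) (tail₂ outC)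

∣-resp-% : ∀ {d} .{{_ : NonZero d}} {x y : ℕ} → x % d ≡ y % d → d ∣ x → d ∣ y
∣-resp-% {d} {x} {y} eq d∣x = m%n≡0⇒n∣m y d (trans (sym eq) (n∣m⇒m%n≡0 x d d∣x))

least : {D : ℕ → Set} → (∀ t → Dec (D t)) → ∀ {b} → D b →
  Σ ℕ λ s → D s × (∀ t → D t → s ≤ t)
least {D} D? {b} Db = search (suc b) (b , ≤-refl , Db)
  where
  noneBelow : ∀ {n} → ¬ (∃ λ (i : Fin n) → D (toℕ i)) → ∀ t → t < n → ¬ D t
  noneBelow none t t<n Dt = none (fromℕ< t<n , subst D (sym (toℕ-fromℕ< t<n)) Dt)

  search : ∀ n → (∃ λ t → t < n × D t) → Σ ℕ λ s → D s × (∀ t → D t → s ≤ t)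
  search zero (_ , () , _)
  search (suc n) w with any? (λ (i : Fin n) → D? (toℕ i))
  ... | yes (i , Di) = search n (toℕ i , toℕ<n i , Di)
  ... | no none with w
  ...   | t , t<1+n , Dt with m≤n⇒m<n∨m≡n (≤-pred t<1+n)
  ...     | inj₁ t<n  = ⊥-elim (noneBelow none t t<n Dt)
  ...     | inj₂ refl = t , Dt , λ t′ Dt′ → ≮⇒≥ (λ t′<t → noneBelow none t′ t′<t Dt′)

argmin : ∀ {j} (f : Fin j → ℕ) (S : Subset j) → Nonempty S →
  ∃ λ i₀ → i₀ ∈ S × (∀ i → i ∈ S → f i₀ ≤ f i)
argmin f S (i , i∈S) with least (λ t → any? (λ i → (i ∈? S) ×-dec (f i ≟ t))) (i , i∈S , refl)
... | _ , (i₀ , i₀∈S , refl) , minimal = i₀ , i₀∈S , λ i i∈S → minimal (f i) (i , i∈S , refl)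

select : ∀ {j} {P : Fin j → Set} → (∀ i → Dec (P i)) → Subset j
select P? = tabulate (λ i → does (P? i))

∈-select⁺ : ∀ {j} {P : Fin j → Set} (P? : ∀ i → Dec (P i)) {i} → P i → i ∈ select P?
∈-select⁺ P? {i} Pi with P? i in eq
... | yes _ = lookup⇒[]= i (select P?) (trans (lookup∘tabulate _ i) (cong does eq))
... | no ¬Pi = ⊥-elim (¬Pi Pi)

∈-select⁻ : ∀ {j} {P : Fin j → Set} (P? : ∀ i → Dec (P i)) {i} → i ∈ select P? → P i
∈-select⁻ P? {i} i∈ with P? i in eq
... | yes Pi = Pi
... | no _ with () ← trans (sym (cong does eq)) (trans (sym (lookup∘tabulate _ i)) ([]=⇒lookup i∈))

img : ∀ {n m} → (Fin n → Fin m) → Subset n → Subset m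
img f []          = ⊥
img f (true ∷ A)  = ⁅ f fzero ⁆ ∪ img (λ i → f (fsuc i)) A
img f (false ∷ A) = img (λ i → f (fsuc i)) A

∈-img⁺ : ∀ {n m} (f : Fin n → Fin m) (A : Subset n) {a} → a ∈ A → f a ∈ img f A
∈-img⁺ f (true ∷ A)  here         = p⊆p∪q {p = ⁅ f fzero ⁆} _ (x∈⁅x⁆ (f fzero))
∈-img⁺ f (true ∷ A)  (there a∈A) = q⊆p∪q ⁅ f fzero ⁆ _ (∈-img⁺ _ A a∈A)
∈-img⁺ f (false ∷ A) (there a∈A) = ∈-img⁺ _ A a∈A

∈-img⁻ : ∀ {n m} (f : Fin n → Fin m) (A : Subset n) {b} → b ∈ img f A →
  ∃ λ a → a ∈ A × f a ≡ b
∈-img⁻ f []          b∈ = ⊥-elim (∉⊥ b∈)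
∈-img⁻ f (true ∷ A)  b∈ with x∈p∪q⁻ ⁅ f fzero ⁆ (img (λ i → f (fsuc i)) A) b∈
... | inj₁ b∈⁅f0⁆ = fzero , here , sym (x∈⁅y⁆⇒x≡y _ b∈⁅f0⁆)
... | inj₂ b∈img with ∈-img⁻ _ A b∈img
...   | a , a∈A , fa≡b = fsuc a , there a∈A , fa≡b
∈-img⁻ f (false ∷ A) b∈ with ∈-img⁻ _ A b∈
... | a , a∈A , fa≡b = fsuc a , there a∈A , fa≡b

∣⁅x⁆∪q∣≤1+∣q∣ : ∀ {m} (x : Fin m) (q : Subset m) → ∣ ⁅ x ⁆ ∪ q ∣ ≤ suc ∣ q ∣
∣⁅x⁆∪q∣≤1+∣q∣ fzero    (true ∷ q)  rewrite ∪-identityˡ q = n≤1+n _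
∣⁅x⁆∪q∣≤1+∣q∣ fzero    (false ∷ q) rewrite ∪-identityˡ q = ≤-refl
∣⁅x⁆∪q∣≤1+∣q∣ (fsuc x) (true ∷ q)  = s≤s (∣⁅x⁆∪q∣≤1+∣q∣ x q)
∣⁅x⁆∪q∣≤1+∣q∣ (fsuc x) (false ∷ q) = ∣⁅x⁆∪q∣≤1+∣q∣ x q

∣img∣≤ : ∀ {n m} (f : Fin n → Fin m) (A : Subset n) → ∣ img f A ∣ ≤ ∣ A ∣
∣img∣≤ {m = m} f []  = ≤-reflexive (∣⊥∣≡0 m)
∣img∣≤ f (true ∷ A)  = ≤-trans (∣⁅x⁆∪q∣≤1+∣q∣ (f fzero) _) (s≤s (∣img∣≤ _ A))
∣img∣≤ f (false ∷ A) = ∣img∣≤ _ A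

-- A function is rebuilt from its head and tail only pointwise, so the
-- predicates are required to be invariant under pointwise equality.
Extensional : ∀ {j n} → ((Fin j → Fin n) → Set) → Set
Extensional {j} {n} P = ∀ {f g : Fin j → Fin n} → (∀ i → f i ≡ g i) → P f → P g

cons : ∀ {j n} → Fin n → (Fin j → Fin n) → Fin (suc j) → Fin n
cons y f fzero    = y
cons y f (fsuc i) = f i

cons-cong : ∀ {j n} (y : Fin n) {f g : Fin j → Fin n} → (∀ i → f i ≡ g i) → ∀ i → cons y f i ≡ cons y g i
cons-cong y eq fzero    = refl
cons-cong y eq (fsuc i) = eq i

cons-η : ∀ {j n} (f : Fin (suc j) → Fin n) → ∀ i → cons (f fzero) (λ i → f (fsuc i)) i ≡ f i
cons-η f fzero    = refl
cons-η f (fsuc i) = refl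

all-functions? : ∀ j {n} (P : (Fin j → Fin n) → Set) → Extensional P →
  (∀ f → Dec (P f)) → Dec (∀ f → P f)
all-functions? zero P ext P? with P? (λ ())
... | yes P[] = yes (λ f → ext (λ ()) P[])
... | no ¬P[] = no (λ ∀P → ¬P[] (∀P _))
all-functions? (suc j) P ext P?
  with all? (λ y → all-functions? j (P ∘ cons y) (ext ∘ cons-cong y) (P? ∘ cons y))
... | yes ∀P = yes (λ f → ext (cons-η f) (∀P (f fzero) (λ i → f (fsuc i))))
... | no ¬∀P = no (λ ∀P → ¬∀P (λ y f → ∀P (cons y f)))

any-function? : ∀ j {n} (P : (Fin j → Fin n) → Set) → Extensional P →
  (∀ f → Dec (P f)) → Dec (Σ (Fin j → Fin n) P)
any-function? zero P ext P? with P? (λ ())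
... | yes P[] = yes (_ , P[])
... | no ¬P[] = no (λ (f , Pf) → ¬P[] (ext (λ ()) Pf))
any-function? (suc j) P ext P?
  with any? (λ y → any-function? j (P ∘ cons y) (ext ∘ cons-cong y) (P? ∘ cons y))
... | yes (y , f , Pf) = yes (cons y f , Pf)
... | no ¬∃P = no (λ (f , Pf) → ¬∃P (f fzero , (λ i → f (fsuc i)) , ext (λ i → sym (cons-η f i)) Pf))

module Decide (n : ℕ) (A : Subset n) where

  Weighted : ∀ {j} → Subset j → (Fin j → Fin n) → Set
  Weighted {j} S a = (i : Fin j) → i ∈ S → a i ∈ A

  Vanishes : ∀ {j} → Subset j → (Fin j → Fin n) → (Fin j → Fin n) → Set
  Vanishes S a x = n ∣ sumS S (λ i → toℕ (a i) * toℕ (x i))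

  HasZeroSum : ∀ {j} → (Fin j → Fin n) → Set
  HasZeroSum {j} x = Σ (Subset j) λ S → Nonempty S × Σ (Fin j → Fin n) λ a → Weighted S a × Vanishes S a x

  Vanishes-cong : ∀ {j} (S : Subset j) {a a′ x x′ : Fin j → Fin n} →
    (∀ i → a i ≡ a′ i) → (∀ i → x i ≡ x′ i) → Vanishes S a x → Vanishes S a′ x′
  Vanishes-cong S eqa eqx = subst (n ∣_) (sumS-cong S (λ i _ → cong₂ (λ u w → toℕ u * toℕ w) (eqa i) (eqx i)))

  hasZeroSum? : ∀ {j} (x : Fin j → Fin n) → Dec (HasZeroSum x)
  hasZeroSum? {j} x = anySubset? λ S → nonempty? S ×-dec any-function? j (λ a → Weighted S a × Vanishes S a x)
    (λ eq (w , v) → (λ i i∈S → subst (_∈ A) (eq i) (w i i∈S)) , Vanishes-cong S eq (λ _ → refl) v)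
    (λ a → all? (λ i → (i ∈? S) →-dec (a i ∈? A)) ×-dec (n ∣? _))

  zeroSumProp? : ∀ j → Dec (ZeroSumProp n A j)
  zeroSumProp? j = all-functions? j HasZeroSum
    (λ eq (S , ne , a , w , v) → S , ne , a , w , Vanishes-cong S {a} (λ _ → refl) eq v) hasZeroSum?

  davenportLE? : ∀ k → Dec (DavenportLE n A k)
  davenportLE? k = map′ fromFin toFin (any? (λ (j : Fin (suc k)) → (1 ≤? toℕ j) ×-dec zeroSumProp? (toℕ j)))
    where
    fromFin : ∃ (λ (j : Fin (suc k)) → (1 ≤ toℕ j) × ZeroSumProp n A (toℕ j)) → DavenportLE n A k
    fromFin (j , 1≤j , Z) = toℕ j , 1≤j , ≤-pred (toℕ<n j) , Z
    toFin : DavenportLE n A k → ∃ (λ (j : Fin (suc k)) → (1 ≤ toℕ j) × ZeroSumProp n A (toℕ j))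
    toFin (j , 1≤j , j≤k , Z) rewrite sym (toℕ-fromℕ< (s≤s j≤k)) = fromℕ< (s≤s j≤k) , 1≤j , Z

admissible? : ∀ n k (A : Subset n) → Dec (Admissible n k A)
admissible? n k A = nonempty? A ×-dec all? (λ a → (a ∈? A) →-dec (1 ≤? toℕ a)) ×-dec Decide.davenportLE? n A k

elems : ∀ {n} → Subset n → List (Fin n)
elems []          = L.[]
elems (true ∷ A)  = fzero L.∷ L.map fsuc (elems A)
elems (false ∷ A) = L.map fsuc (elems A)

length-elems : ∀ {n} (A : Subset n) → length (elems A) ≡ ∣ A ∣
length-elems []          = refl
length-elems (true ∷ A)  = cong suc (trans (length-map fsuc (elems A)) (length-elems A))
length-elems (false ∷ A) = trans (length-map fsuc (elems A)) (length-elems A)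

∈-elems⁺ : ∀ {n} (A : Subset n) {a} → a ∈ A → a ∈ₗ elems A
∈-elems⁺ (true ∷ A)  here        = Any.here refl
∈-elems⁺ (true ∷ A)  (there a∈A) = Any.there (∈-map⁺ fsuc (∈-elems⁺ A a∈A))
∈-elems⁺ (false ∷ A) (there a∈A) = ∈-map⁺ fsuc (∈-elems⁺ A a∈A)

∈-elems⁻ : ∀ {n} (A : Subset n) {a} → a ∈ₗ elems A → a ∈ A
∈-elems⁻ (true ∷ A) (Any.here refl) = here
∈-elems⁻ (true ∷ A) (Any.there a∈) with ∈-map⁻ fsuc a∈
... | b , b∈ , refl = there (∈-elems⁻ A b∈)
∈-elems⁻ (false ∷ A) a∈ with ∈-map⁻ fsuc a∈
... | b , b∈ , refl = there (∈-elems⁻ A b∈)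

length-cartesianProductWith : ∀ {X Y Z : Set} (f : X → Y → Z) (xs : List X) (ys : List Y) →
  length (cartesianProductWith f xs ys) ≡ length xs * length ys
length-cartesianProductWith f L.[]       ys = refl
length-cartesianProductWith f (x L.∷ xs) ys =
  trans (length-++ (L.map (f x) ys)) (cong₂ _+_ (length-map (f x) ys) (length-cartesianProductWith f xs ys))

∣∧<⇒≡0 : ∀ {p δ} → p ∣ δ → δ < p → δ ≡ 0
∣∧<⇒≡0 {δ = zero}  _   _   = refl
∣∧<⇒≡0 {δ = suc _} p∣δ δ<p = ⊥-elim (>⇒∤ δ<p p∣δ)

-- The normalisation used for the difference of two solutions.
distrib-shift : ∀ c y δ t → c * (y + δ) + t ≡ (c * y + t) + c * δ
distrib-shift = solve-∀

-- For a prime p and 0 < c < p, two solutions y and y + δ in [0, p) of the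
-- linear congruence c·y + t ≡ 0 (mod p) coincide: p ∣ c·δ forces p ∣ δ.
root-shift≡0 : ∀ {p} → Prime p → ∀ {c t y δ} → 1 ≤ c → c < p → y + δ < p →
  p ∣ c * y + t → p ∣ c * (y + δ) + t → δ ≡ 0
root-shift≡0 {p} p-prime {c} {t} {y} {δ} 1≤c c<p y+δ<p d d′
  with euclidsLemma c δ p-prime (∣m+n∣m⇒∣n (subst (p ∣_) (distrib-shift c y δ t) d′) d)
... | inj₁ p∣c = ⊥-elim (>⇒∤ {{>-nonZero 1≤c}} c<p p∣c)
... | inj₂ p∣δ = ∣∧<⇒≡0 p∣δ (≤-<-trans (m≤n+m δ y) y+δ<p)

linear-root-unique-≤ : ∀ {p} → Prime p → ∀ {c t y y′} → 1 ≤ c → c < p → y ≤ y′ → y′ < p →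
  p ∣ c * y + t → p ∣ c * y′ + t → y ≡ y′
linear-root-unique-≤ {p} p-prime {c} {t} {y} {y′} 1≤c c<p y≤y′ y′<p d d′ = begin
    y           ≡⟨ +-identityʳ y ⟨
    y + 0       ≡⟨ cong (y +_) δ≡0 ⟨
    y + δ       ≡⟨ y+δ≡y′ ⟩
    y′          ∎
  where
  open ≡-Reasoning
  δ : ℕ
  δ = y′ ∸ y
  y+δ≡y′ : y + δ ≡ y′
  y+δ≡y′ = m+[n∸m]≡n y≤y′
  δ≡0 : δ ≡ 0
  δ≡0 = root-shift≡0 p-prime 1≤c c<p (subst (_< p) (sym y+δ≡y′) y′<p) d
          (subst (λ z → p ∣ c * z + t) (sym y+δ≡y′) d′)

linear-root-unique : ∀ {p} → Prime p → ∀ {c t y₁ y₂} → 1 ≤ c → c < p → y₁ < p → y₂ < p →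
  p ∣ c * y₁ + t → p ∣ c * y₂ + t → y₁ ≡ y₂
linear-root-unique p-prime 1≤c c<p y₁<p y₂<p d₁ d₂ with ≤-total _ _
... | inj₁ y₁≤y₂ = linear-root-unique-≤ p-prime 1≤c c<p y₁≤y₂ y₂<p d₁ d₂
... | inj₂ y₂≤y₁ = sym (linear-root-unique-≤ p-prime 1≤c c<p y₂≤y₁ y₁<p d₂ d₁)

-- A sequence
-- r₁ … r_j in ℤ_p without weighted zero-sum subsequence is built greedily:
-- a new term y is forbidden only if c·y + t ≡ 0 (mod p) for a weight c ∈ A
-- and a weighted subsum t of the previous terms; each of the s·(s+1)^j such
-- pairs forbids at most one y.
module LowerBound {p : ℕ} (p-prime : Prime p) (A : Subset p) (A-range : InRange A) where

  open Decide p A using (Weighted; Vanishes)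

  s : ℕ
  s = ∣ A ∣

  weights : List ℕ
  weights = L.map toℕ (elems A)

  length-weights : length weights ≡ s
  length-weights = trans (length-map toℕ (elems A)) (length-elems A)

  weight∈ : ∀ {a} → a ∈ A → toℕ a ∈ₗ weights
  weight∈ a∈A = ∈-map⁺ toℕ (∈-elems⁺ A a∈A)

  weight-range : ∀ {c} → c ∈ₗ weights → 1 ≤ c × c < p
  weight-range c∈ with ∈-map⁻ toℕ c∈
  ... | a , a∈ , refl = A-range a (∈-elems⁻ A a∈) , toℕ<n a

  subsums : ∀ j → (Fin j → Fin p) → List ℕ
  subsums zero    r = 0 L.∷ L.[]
  subsums (suc j) r = subsums j (r ∘ fsuc) ++
    cartesianProductWith (λ c t → c * toℕ (r fzero) + t) weights (subsums j (r ∘ fsuc))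

  length-subsums : ∀ j r → length (subsums j r) ≡ suc s ^ j
  length-subsums zero    r = refl
  length-subsums (suc j) r = begin
      length (subsums j (r ∘ fsuc) ++ new)
    ≡⟨ length-++ (subsums j (r ∘ fsuc)) ⟩
      length (subsums j (r ∘ fsuc)) + length new
    ≡⟨ cong (length (subsums j (r ∘ fsuc)) +_) (length-cartesianProductWith _ weights _) ⟩
      length (subsums j (r ∘ fsuc)) + length weights * length (subsums j (r ∘ fsuc))
    ≡⟨ cong₂ (λ ℓ w → ℓ + w * ℓ) (length-subsums j (r ∘ fsuc)) length-weights ⟩
      suc s ^ suc j ∎
    where
    open ≡-Reasoning
    new : List ℕ
    new = cartesianProductWith (λ c t → c * toℕ (r fzero) + t) weights (subsums j (r ∘ fsuc))

  subsum-listed : ∀ j r (S : Subset j) a → Weighted S a →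
    sumS S (λ i → toℕ (a i) * toℕ (r i)) ∈ₗ subsums j r
  subsum-listed zero    r []          a w = Any.here refl
  subsum-listed (suc j) r (true ∷ S)  a w =
    ∈-++⁺ʳ (subsums j (r ∘ fsuc)) (∈-cartesianProductWith⁺ _ (weight∈ (w fzero here))
      (subsum-listed j (r ∘ fsuc) S (a ∘ fsuc) (tail w)))
  subsum-listed (suc j) r (false ∷ S) a w =
    ∈-++⁺ˡ (subsum-listed j (r ∘ fsuc) S (a ∘ fsuc) (tail w))

  Forbidden : List ℕ → Fin p → Set
  Forbidden L y = Any (λ ct → p ∣ proj₁ ct * toℕ y + proj₂ ct) (cartesianProduct weights L)

  -- Fewer than p pairs cannot forbid every y (pigeonhole + uniqueness of roots).
  avoid : ∀ L → s * length L < p → ∃ λ y → ¬ Forbidden L y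
  avoid L few = ¬∀⟶∃¬ p (Forbidden L) (λ y → Any.any? (λ _ → p ∣? _) _) ¬allForbidden
    where
    pairs : List (ℕ × ℕ)
    pairs = cartesianProduct weights L
    length-pairs : length pairs ≡ s * length L
    length-pairs = trans (length-cartesianProductWith _,_ weights L) (cong (_* length L) length-weights)
    ¬allForbidden : ¬ (∀ y → Forbidden L y)
    ¬allForbidden forb with pigeonhole (subst (_< p) (sym length-pairs) few) (λ y → Any.index (forb y))
    ... | y₁ , y₂ , y₁<y₂ , same = <-irrefl (linear-root-unique p-prime 1≤c c<p (toℕ<n y₁) (toℕ<n y₂) d₁ d₂) y₁<y₂
      where
      ct : ℕ × ℕ
      ct = L.lookup pairs (Any.index (forb y₁))
      d₁ : p ∣ proj₁ ct * toℕ y₁ + proj₂ ct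
      d₁ = lookup-index (forb y₁)
      d₂ : p ∣ proj₁ ct * toℕ y₂ + proj₂ ct
      d₂ = subst (λ i → p ∣ proj₁ (L.lookup pairs i) * toℕ y₂ + proj₂ (L.lookup pairs i)) (sym same) (lookup-index (forb y₂))
      c-range : 1 ≤ proj₁ ct × proj₁ ct < p
      c-range = weight-range (proj₁ (∈-cartesianProduct⁻ weights L (∈-lookup (Any.index (forb y₁)))))
      1≤c : 1 ≤ proj₁ ct
      1≤c = proj₁ c-range
      c<p : proj₁ ct < p
      c<p = proj₂ c-range

  ZeroSumFree : ∀ j → (Fin j → Fin p) → Set
  ZeroSumFree j r = ∀ (S : Subset j) → Nonempty S → ∀ a → Weighted S a → ¬ Vanishes S a r

  zeroSumFree : ∀ j → (∀ j′ → j′ < j → s * suc s ^ j′ < p) → Σ (Fin j → Fin p) (ZeroSumFree j)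
  zeroSumFree zero    few = (λ ()) , λ { S (() , _) }
  zeroSumFree (suc j) few with zeroSumFree j (λ j′ j′<j → few j′ (m<n⇒m<1+n j′<j))
  ... | r , free with avoid (subsums j r) (subst (λ ℓ → s * ℓ < p) (sym (length-subsums j r)) (few j ≤-refl))
  ...   | y , allowed = cons y r , free′
    where
    free′ : ZeroSumFree (suc j) (cons y r)
    free′ (true ∷ S)  _                  a w v = allowed (Any.map (λ { refl → v })
      (∈-cartesianProduct⁺ (weight∈ (w fzero here)) (subsum-listed j r S (a ∘ fsuc) (tail w))))
    free′ (false ∷ S) (fsuc i , there i∈S) a w v = free S (i , i∈S) (a ∘ fsuc) (tail w) v

  -- If (s+1)^k < p, a zero-sum free sequence of length j ≤ k contradicts
  -- D_A(ℤ_p) ≤ k.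
  lowerBound : ∀ k → DavenportLE p A k → p ≤ suc s ^ k
  lowerBound k (j , _ , j≤k , Z) = ≮⇒≥ λ big → noZeroSum (zeroSumFree j (few big))
    where
    few : suc s ^ k < p → ∀ j′ → j′ < j → s * suc s ^ j′ < p
    few big j′ j′<j = ≤-<-trans (≤-trans (m≤n+m (s * suc s ^ j′) (suc s ^ j′)) (^-monoʳ-≤ (suc s) (≤-trans j′<j j≤k))) big
    noZeroSum : ¬ Σ (Fin j → Fin p) (ZeroSumFree j)
    noZeroSum (r , free) with Z r
    ... | S , ne , a , w , v = free S ne a w v

transport : ∀ {n n′ k} (f : Fin n → Fin n′) (A : Subset n) →
  (∀ a → 1 ≤ toℕ a → 1 ≤ toℕ (f a)) →
  (∀ j → ZeroSumProp n A j → ZeroSumProp n′ (img f A) j) →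
  Admissible n k A → Admissible n′ k (img f A)
transport f A f-nonzero zeroSum ((a , a∈A) , A-range , (j , 1≤j , j≤k , Z)) =
  (f a , ∈-img⁺ f A a∈A) , fA-range , (j , 1≤j , j≤k , zeroSum j Z)
  where
  fA-range : InRange (img f A)
  fA-range b b∈fA with ∈-img⁻ f A b∈fA
  ... | a′ , a′∈A , refl = f-nonzero a′ (A-range a′ a′∈A)

[m*[n%d]]%d≡[m*n]%d : ∀ m n d .{{_ : NonZero d}} → (m * (n % d)) % d ≡ (m * n) % d
[m*[n%d]]%d≡[m*n]%d m n d = begin
    (m * (n % d)) % d            ≡⟨ %-distribˡ-* m (n % d) d ⟩
    ((m % d) * (n % d % d)) % d  ≡⟨ cong (λ z → ((m % d) * z) % d) (m%n%n≡m%n n d) ⟩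
    ((m % d) * (n % d)) % d      ≡⟨ %-distribˡ-* m n d ⟨
    (m * n) % d                  ∎
  where open ≡-Reasoning

[[m%d]*n]%d≡[m*n]%d : ∀ m n d .{{_ : NonZero d}} → ((m % d) * n) % d ≡ (m * n) % d
[[m%d]*n]%d≡[m*n]%d m n d =
  trans (cong (_% d) (*-comm (m % d) n)) (trans ([m*[n%d]]%d≡[m*n]%d n m d) (cong (_% d) (*-comm n m)))

-- A weighted zero sum
-- for the residues x_i mod n of a sequence x in ℤ_{n·c} with weights b_i is
-- a zero sum for x itself in ℤ_n, and multiplying by c gives a zero sum in
-- ℤ_{n·c} with weights c·b_i.
module Lift (n c : ℕ) .{{_ : NonZero n}} .{{_ : NonZero c}} where

  scale : Fin n → Fin (n * c)
  scale b = fromℕ< (subst (c * toℕ b <_) (*-comm c n) (*-monoʳ-< c (toℕ<n b)))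

  toℕ-scale : ∀ b → toℕ (scale b) ≡ c * toℕ b
  toℕ-scale b = toℕ-fromℕ< _

  reduce : Fin (n * c) → Fin n
  reduce x = fromℕ< (m%n<n (toℕ x) n)

  toℕ-reduce : ∀ x → toℕ (reduce x) ≡ toℕ x % n
  toℕ-reduce x = toℕ-fromℕ< _

  lift : ∀ k (B : Subset n) → Admissible n k B → Admissible (n * c) k (img scale B)
  lift k B = transport scale B scale-nonzero liftZeroSum
    where
    scale-nonzero : ∀ b → 1 ≤ toℕ b → 1 ≤ toℕ (scale b)
    scale-nonzero b 1≤b = subst (1 ≤_) (sym (toℕ-scale b)) (*-mono-≤ (>-nonZero⁻¹ c) 1≤b)

    liftZeroSum : ∀ j → ZeroSumProp n B j → ZeroSumProp (n * c) (img scale B) j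
    liftZeroSum j Z x with Z (reduce ∘ x)
    ... | S , ne , b , w , v = S , ne , scale ∘ b , (λ i i∈S → ∈-img⁺ scale B (w i i∈S)) , n*c∣sum
      where
      n∣sum : n ∣ sumS S (λ i → toℕ (b i) * toℕ (x i))
      n∣sum = ∣-resp-% (sumS-% S λ i _ → trans (cong (λ r → (toℕ (b i) * r) % n) (toℕ-reduce (x i)))
                                                  ([m*[n%d]]%d≡[m*n]%d (toℕ (b i)) (toℕ (x i)) n)) v
      scaled-sum : sumS S (λ i → toℕ (scale (b i)) * toℕ (x i)) ≡ c * sumS S (λ i → toℕ (b i) * toℕ (x i))
      scaled-sum = trans (sumS-cong S λ i _ → trans (cong (_* toℕ (x i)) (toℕ-scale (b i))) (*-assoc c _ _))
                         (sumS-* S c _)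
      n*c∣sum : n * c ∣ sumS S (λ i → toℕ (scale (b i)) * toℕ (x i))
      n*c∣sum = subst₂ _∣_ (*-comm c n) (sym scaled-sum) (*-monoʳ-∣ c n∣sum)

record Factorisation (p a : ℕ) : Set where
  constructor factorisation
  field
    valuation unit : ℕ
    factors        : a ≡ p ^ valuation * unit
    unit-coprime   : 0 < a → ¬ p ∣ unit

factorise : ∀ {p} → 2 ≤ p → ∀ a → Factorisation p a
factorise {p} 2≤p = <-rec (Factorisation p) step
  where
  step : ∀ a → (∀ {b} → b < a → Factorisation p b) → Factorisation p a
  step zero    _   = factorisation 0 0 refl λ ()
  step (suc a) rec with p ∣? suc a
  ... | no p∤a = factorisation 0 (suc a) (sym (+-identityʳ (suc a))) (λ _ → p∤a)
  ... | yes (divides (suc q) a≡q*p) = factorisation (suc valuation) unit factors′ (λ _ → unit-coprime z<s)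
    where
    open Factorisation (rec (subst (suc q <_) (sym a≡q*p) (m<m*n (suc q) p 2≤p)))
    factors′ : suc a ≡ p ^ suc valuation * unit
    factors′ = begin
        suc a                          ≡⟨ a≡q*p ⟩
        suc q * p                      ≡⟨ *-comm (suc q) p ⟩
        p * suc q                      ≡⟨ cong (p *_) factors ⟩
        p * (p ^ valuation * unit)     ≡⟨ *-assoc p _ unit ⟨
        p ^ suc valuation * unit       ∎
      where open ≡-Reasoning

p∣p^e : ∀ p {e} → 1 ≤ e → p ∣ p ^ e
p∣p^e p {suc e} _ = m∣m*n (p ^ e)

-- Descent from ℤ_{p^m} to ℤ_p (p ≥ 2, m ≥ 1) along a ↦ (unit part of a) mod p.
-- Given a zero sum Σ_{i∈S} a_i y_i ≡ 0 (mod p^m) with 0 < a_i < p^m, write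
-- a_i = p^{v_i} u_i and let t = min v_i < m.  Dividing by p^t leaves
-- Σ_{i∈S} p^{v_i - t} u_i y_i ≡ 0 (mod p), and the terms with v_i > t drop
-- out, so Σ_{i∈S′} (u_i mod p) y_i ≡ 0 (mod p) on the indices S′ of minimal
-- valuation.
module Descend (p m′ : ℕ) (2≤p : 2 ≤ p) where

  instance
    p≢0 : NonZero p
    p≢0 = >-nonZero (<-trans z<s 2≤p)

  open Factorisation

  P : ℕ
  P = p ^ suc m′

  val unit′ : ℕ → ℕ
  val   a = valuation (factorise 2≤p a)
  unit′ a = unit (factorise 2≤p a)

  unit%p-nonzero : ∀ a → 1 ≤ a → 1 ≤ unit′ a % p
  unit%p-nonzero a 1≤a with unit′ a % p in eq
  ... | zero  = ⊥-elim (unit-coprime (factorise 2≤p a) 1≤a (m%n≡0⇒n∣m _ p eq))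
  ... | suc _ = s≤s z≤n

  unit-positive : ∀ a → 1 ≤ a → 1 ≤ unit′ a
  unit-positive a 1≤a with unit′ a in eq
  ... | suc _ = s≤s z≤n
  ... | zero  = ⊥-elim (<⇒≢ 1≤a (sym a≡0))
    where
    a≡0 : a ≡ 0
    a≡0 = trans (factors (factorise 2≤p a)) (trans (cong (p ^ val a *_) eq) (*-zeroʳ (p ^ val a)))

  val<m : ∀ a → 1 ≤ a → a < P → val a < suc m′
  val<m a 1≤a a<P = ≰⇒> λ m≤val → <⇒≱ a<P (begin
      P                    ≤⟨ ^-monoʳ-≤ p m≤val ⟩
      p ^ val a            ≤⟨ m≤m*n (p ^ val a) (unit′ a) {{>-nonZero (unit-positive a 1≤a)}} ⟩
      p ^ val a * unit′ a  ≡⟨ factors (factorise 2≤p a) ⟨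
      a                    ∎)
    where open ≤-Reasoning

  descend-sum : ∀ {j} (S : Subset j) → Nonempty S → (a y : Fin j → ℕ) →
    (∀ i → i ∈ S → 1 ≤ a i × a i < P) → P ∣ sumS S (λ i → a i * y i) →
    Σ (Subset j) λ S′ → Nonempty S′ × S′ ⊆ S × p ∣ sumS S′ (λ i → unit′ (a i) % p * y i)
  descend-sum {j} S ne a y range P∣sum with argmin (val ∘ a) S ne
  ... | i₀ , i₀∈S , minimal =
    S ∩ Mins , (i₀ , x∈p∩q⁺ (i₀∈S , ∈-select⁺ Min? refl)) , p∩q⊆p S Mins ,
    ∣-resp-% (sumS-%-∩ S Mins minimal-term other-term) p∣terms
    where
    t : ℕ
    t = val (a i₀)

    Min? : ∀ i → Dec (val (a i) ≡ t)
    Min? i = val (a i) ≟ t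

    Mins : Subset j
    Mins = select Min?

    term : Fin j → ℕ
    term i = p ^ (val (a i) ∸ t) * (unit′ (a i) * y i)

    factor-term : ∀ i → i ∈ S → a i * y i ≡ p ^ t * term i
    factor-term i i∈S = begin
        a i * y i
      ≡⟨ cong (_* y i) (factors (factorise 2≤p (a i))) ⟩
        p ^ val (a i) * unit′ (a i) * y i
      ≡⟨ *-assoc (p ^ val (a i)) _ _ ⟩
        p ^ val (a i) * (unit′ (a i) * y i)
      ≡⟨ cong (λ e → p ^ e * (unit′ (a i) * y i)) (m+[n∸m]≡n (minimal i i∈S)) ⟨
        p ^ (t + (val (a i) ∸ t)) * (unit′ (a i) * y i)
      ≡⟨ cong (_* (unit′ (a i) * y i)) (^-distribˡ-+-* p t _) ⟩
        p ^ t * p ^ (val (a i) ∸ t) * (unit′ (a i) * y i)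
      ≡⟨ *-assoc (p ^ t) _ _ ⟩
        p ^ t * term i ∎
      where open ≡-Reasoning

    t<m : t < suc m′
    t<m = val<m (a i₀) (proj₁ (range i₀ i₀∈S)) (proj₂ (range i₀ i₀∈S))

    -- Since t < m, cancelling p^t from P ∣ p^t · Σ term leaves a factor p.
    p∣terms : p ∣ sumS S term
    p∣terms = ∣-trans (p∣p^e p (m<n⇒0<n∸m t<m)) (*-cancelˡ-∣ (p ^ t) {{m^n≢0 p t}} (subst₂ _∣_ P≡ sum≡ P∣sum))
      where
      P≡ : P ≡ p ^ t * p ^ (suc m′ ∸ t)
      P≡ = trans (cong (p ^_) (sym (m+[n∸m]≡n (<⇒≤ t<m)))) (^-distribˡ-+-* p t _)
      sum≡ : sumS S (λ i → a i * y i) ≡ p ^ t * sumS S term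
      sum≡ = trans (sumS-cong S factor-term) (sumS-* S (p ^ t) term)

    minimal-term : ∀ i → i ∈ S → i ∈ Mins → term i % p ≡ (unit′ (a i) % p * y i) % p
    minimal-term i _ i∈Mins = begin
        term i % p
      ≡⟨ cong (λ e → (p ^ (e ∸ t) * (unit′ (a i) * y i)) % p) (∈-select⁻ Min? i∈Mins) ⟩
        (p ^ (t ∸ t) * (unit′ (a i) * y i)) % p
      ≡⟨ cong (λ e → (p ^ e * (unit′ (a i) * y i)) % p) (n∸n≡0 t) ⟩
        (1 * (unit′ (a i) * y i)) % p
      ≡⟨ cong (_% p) (*-identityˡ _) ⟩
        (unit′ (a i) * y i) % p
      ≡⟨ [[m%d]*n]%d≡[m*n]%d (unit′ (a i)) (y i) p ⟨
        (unit′ (a i) % p * y i) % p ∎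
      where open ≡-Reasoning

    other-term : ∀ i → i ∈ S → i ∈ ∁ Mins → p ∣ term i
    other-term i i∈S i∈∁Mins = ∣m⇒∣m*n _ (p∣p^e p (m<n⇒0<n∸m t<val))
      where
      t<val : t < val (a i)
      t<val = ≤∧≢⇒< (minimal i i∈S) (λ t≡val → x∈∁p⇒x∉p i∈∁Mins (∈-select⁺ Min? (sym t≡val)))

  embed : Fin p → Fin P
  embed y = fromℕ< (<-≤-trans (toℕ<n y) (m≤m*n p (p ^ m′) {{m^n≢0 p m′}}))

  residue : Fin P → Fin p
  residue a = fromℕ< (m%n<n (unit′ (toℕ a)) p)

  toℕ-embed : ∀ y → toℕ (embed y) ≡ toℕ y
  toℕ-embed y = toℕ-fromℕ< _

  toℕ-residue : ∀ a → toℕ (residue a) ≡ unit′ (toℕ a) % p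
  toℕ-residue a = toℕ-fromℕ< _

  descendZeroSum : ∀ (A : Subset P) → InRange A → ∀ j → ZeroSumProp P A j → ZeroSumProp p (img residue A) j
  descendZeroSum A A-range j Z y = descended (Z (embed ∘ y))
    where
    descended : Decide.HasZeroSum P A (embed ∘ y) → Decide.HasZeroSum p (img residue A) y
    descended (S , ne , a , w , P∣sum) = reduced (descend-sum S ne (toℕ ∘ a) (toℕ ∘ y) range P∣sum′)
      where
      range : ∀ i → i ∈ S → 1 ≤ toℕ (a i) × toℕ (a i) < P
      range i i∈S = A-range (a i) (w i i∈S) , toℕ<n (a i)
      P∣sum′ : P ∣ sumS S (λ i → toℕ (a i) * toℕ (y i))
      P∣sum′ = subst (P ∣_) (sumS-cong S {λ i → toℕ (a i) * toℕ (embed (y i))} {λ i → toℕ (a i) * toℕ (y i)}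
                             λ i _ → cong (toℕ (a i) *_) (toℕ-embed (y i))) P∣sum
      reduced : (Σ (Subset j) λ S′ → Nonempty S′ × S′ ⊆ S × p ∣ sumS S′ (λ i → unit′ (toℕ (a i)) % p * toℕ (y i))) →
        Decide.HasZeroSum p (img residue A) y
      reduced (S′ , ne′ , S′⊆S , p∣sum) = S′ , ne′ , residue ∘ a , (λ i i∈S′ → ∈-img⁺ residue A (w i (S′⊆S i∈S′))) ,
        subst (p ∣_) (sumS-cong S′ {λ i → unit′ (toℕ (a i)) % p * toℕ (y i)} {λ i → toℕ (residue (a i)) * toℕ (y i)}
                        λ i _ → cong (_* toℕ (y i)) (sym (toℕ-residue (a i)))) p∣sum

  descend : ∀ k (A : Subset P) → Admissible P k A → Admissible p k (img residue A)
  descend k A adm@(_ , A-range , _) = transport residue A residue-nonzero (descendZeroSum A A-range) adm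
    where
    residue-nonzero : ∀ a → 1 ≤ toℕ a → 1 ≤ toℕ (residue a)
    residue-nonzero a 1≤a = subst (1 ≤_) (sym (toℕ-residue a)) (unit%p-nonzero (toℕ a) 1≤a)

-- The value of f^(D)(n,k) exists: admissibility is decidable, so either no
-- admissible set exists or there is one of least size.
fD-exists : ∀ n k → Σ (Maybe ℕ) (fD n k)
fD-exists n k with anySubset? (admissible? n k)
... | no none = nothing , λ A adm → none (A , adm)
... | yes (A , adm) with least (λ s → anySubset? (λ B → admissible? n k B ×-dec (∣ B ∣ ≟ s))) (A , adm , refl)
...   | s , witness , minimal = just s , witness , λ B adm-B → minimal ∣ B ∣ (B , adm-B , refl)

-- If admissibility is transported along f : ℤ_n → ℤ_n′ and g : ℤ_n′ → ℤ_n,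
-- then f^(D)(n,k) = f^(D)(n′,k), since images are no larger than the sets.
fD-transfer : ∀ {n n′} k (f : Fin n → Fin n′) (g : Fin n′ → Fin n) →
  (∀ A → Admissible n k A → Admissible n′ k (img f A)) →
  (∀ A → Admissible n′ k A → Admissible n k (img g A)) →
  ∀ v → fD n k v → fD n′ k v
fD-transfer k f g f-adm g-adm (just s) ((A , adm , ∣A∣≡s) , minimal) =
  (img f A , f-adm A adm , ≤-antisym (≤-trans (∣img∣≤ f A) (≤-reflexive ∣A∣≡s)) (minimal′ _ (f-adm A adm))) , minimal′
  where
  minimal′ : ∀ B → Admissible _ k B → s ≤ ∣ B ∣
  minimal′ B adm-B = ≤-trans (minimal (img g B) (g-adm B adm-B)) (∣img∣≤ g B)
fD-transfer k f g f-adm g-adm nothing none = λ B adm-B → none (img g B) (g-adm B adm-B)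


fD-lower : ∀ {p} → Prime p → ∀ {k s} → fD p k (just s) → p ≤ (s + 1) ^ k
fD-lower {p} p-prime {k} ((A , (_ , A-range , D≤k) , refl) , _) =
  subst (λ z → p ≤ z ^ k) (+-comm 1 ∣ A ∣) (LowerBound.lowerBound p-prime A A-range k D≤k)

theorem3 : (p m k : ℕ) → Prime p → 1 ≤ m → 2 ≤ k →
    Σ (Maybe ℕ) λ v → fD (p ^ m) k v × fD p k v ×
      ((s : ℕ) → v ≡ just s → p ≤ (s + 1) ^ k)
theorem3 p@(suc (suc _)) (suc m′) k p-prime _ _ =
  v , fD-transfer k scale residue (lift k) (descend k) v fD-p , fD-p , bound
  where
  open Lift p (p ^ m′) {{_}} {{m^n≢0 p m′}} using (scale; lift)
  open Descend p m′ (s≤s (s≤s z≤n)) using (residue; descend)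
  v : Maybe ℕ
  v = proj₁ (fD-exists p k)
  fD-p : fD p k v
  fD-p = proj₂ (fD-exists p k)
  bound : (s : ℕ) → v ≡ just s → p ≤ (s + 1) ^ k
  bound s v≡s = fD-lower p-prime (subst (fD p k) v≡s fD-p)
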